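{- For every integer $n\ge 2$, \[ \sum_{i=1}^{n}(q^{i-1}+q^{i}+q^{i+1})\,[i]_q^3\;+\;\sum_{i=1}^{n}\big(q^{i-1}[i-1]_q+q^{i}\big)\,[i]_q^2\;=\;[n+1]_q^2\,[n]_q^2 . \]
   Context: For a non-negative integer $k$, $[k]_q=(1-q^k)/(1-q)=1+q+\cdots+q^{k-1}$ (so $[0]_q=0$); the identity is an identity of polynomials in $q$. -}

module Defs where

open import Level using (Level)
open import Data.Nat using (ℕ; zero; suc) renaming (_∸_ to _∸ℕ_)
open import Algebra.Bundles using (CommutativeRing)

module _ {c ℓ : Level} (R : CommutativeRing c ℓ) where
  open CommutativeRing R hiding (zero)

  qpow : Carrier → ℕ → Carrier
  qpow q zero    = 1#
  qpow q (suc k) = q * qpow q k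

  qint : Carrier → ℕ → Carrier
  qint q zero    = 0#
  qint q (suc k) = qint q k + qpow q k

  sum1 : ℕ → (ℕ → Carrier) → Carrier
  sum1 zero    f = 0#
  sum1 (suc n) f = sum1 n f + f (suc n)

  cube : Carrier → Carrier
  cube x = x * x * x

  sq : Carrier → Carrier
  sq x = x * x

  lhs : Carrier → ℕ → Carrier
  lhs q n =
    sum1 n (λ i → (qpow q (i ∸ℕ 1) + qpow q i + qpow q (suc i)) * cube (qint q i))
    + sum1 n (λ i → (qpow q (i ∸ℕ 1) * qint q (i ∸ℕ 1) + qpow q i) * sq (qint q i))

  rhs : Carrier → ℕ → Carrier
  rhs q n = sq (qint q (suc n)) * sq (qint q n)

{-# OPTIONS --safe #-}
module Submission where

-- The right-hand side telescopes. With a = [n]_q and p = q^n, so that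
-- [n+1]_q = a + p = 1 + q a and [n+2]_q = a + p + q p, the increment of
-- [n+1]_q^2 [n]_q^2 at n+1 is the (n+1)-st summand of the left-hand side; this is a
-- polynomial identity in q, a, p modulo the relation q a + 1 = a + p.

open import Defs
open import Level using (Level)
open import Data.Nat using (ℕ; _≤_; zero; suc; _∸_)
open import Algebra.Bundles using (CommutativeRing)
import Algebra.Properties.Ring as RingProperties
import Algebra.Solver.Ring.NaturalCoefficients.Default as NaturalCoefficientSolver
import Relation.Binary.Reasoning.Setoid as SetoidReasoning

module _ {c ℓ : Level} (R : CommutativeRing c ℓ) where
  open CommutativeRing R hiding (zero)
  open RingProperties ring using (+-cancelʳ)
  open NaturalCoefficientSolver commutativeSemiring
  open SetoidReasoning setoid

  sum1-distrib-+ : ∀ n (f g : ℕ → Carrier) →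
                   sum1 R n f + sum1 R n g ≈ sum1 R n (λ i → f i + g i)
  sum1-distrib-+ zero    f g = +-identityˡ 0#
  sum1-distrib-+ (suc n) f g = begin
    (sum1 R n f + f (suc n)) + (sum1 R n g + g (suc n))
      ≈⟨ +-comm-middle (sum1 R n f) (f (suc n)) (sum1 R n g) (g (suc n)) ⟩
    (sum1 R n f + sum1 R n g) + (f (suc n) + g (suc n))
      ≈⟨ +-congʳ (sum1-distrib-+ n f g) ⟩
    sum1 R n (λ i → f i + g i) + (f (suc n) + g (suc n)) ∎
    where
    +-comm-middle : ∀ w x y z → (w + x) + (y + z) ≈ (w + y) + (x + z)
    +-comm-middle = solve 4 (λ w x y z → (w :+ x) :+ (y :+ z) := (w :+ y) :+ (x :+ z)) refl

  sum1-telescope : (F f : ℕ → Carrier) → (∀ i → F (suc i) ≈ F i + f (suc i)) →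
                   ∀ n → F 0 + sum1 R n f ≈ F n
  sum1-telescope F f step zero    = +-identityʳ (F 0)
  sum1-telescope F f step (suc n) = begin
    F 0 + (sum1 R n f + f (suc n))  ≈⟨ +-assoc (F 0) (sum1 R n f) (f (suc n)) ⟨
    (F 0 + sum1 R n f) + f (suc n)  ≈⟨ +-congʳ (sum1-telescope F f step n) ⟩
    F n + f (suc n)                 ≈⟨ step n ⟨
    F (suc n)                       ∎

  q*qint+1≈qint-suc : ∀ q n → q * qint R q n + 1# ≈ qint R q (suc n)
  q*qint+1≈qint-suc q zero    = +-congʳ (zeroʳ q)
  q*qint+1≈qint-suc q (suc n) = begin
    q * (a + p) + 1#     ≈⟨ solve 3 (λ q a p → q :* (a :+ p) :+ con 1 := (q :* a :+ con 1) :+ q :* p)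
                                    refl q a p ⟩
    (q * a + 1#) + q * p ≈⟨ +-congʳ (q*qint+1≈qint-suc q n) ⟩
    (a + p) + q * p      ∎
    where
    a p : Carrier
    a = qint R q n
    p = qpow R q n

  -- The two sides differ by b² q p (a + p − q a − 1), where b = a + p.
  rhs-step-identity : ∀ q a p → q * a + 1# ≈ a + p →
    sq R (a + p + q * p) * sq R (a + p)
      ≈ sq R (a + p) * sq R a
        + ((p + q * p + q * (q * p)) * cube R (a + p) + (p * a + q * p) * sq R (a + p))
  rhs-step-identity q a p recurrence = +-cancelʳ (u * (a + p)) _ _ (begin
    sq R (a + p + q * p) * sq R (a + p) + u * (a + p)
      ≈⟨ +-congˡ (*-congˡ recurrence) ⟨
    sq R (a + p + q * p) * sq R (a + p) + u * (q * a + 1#)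
      ≈⟨ polynomial-identity q a p ⟩
    sq R (a + p) * sq R a
      + ((p + q * p + q * (q * p)) * cube R (a + p) + (p * a + q * p) * sq R (a + p))
      + u * (a + p) ∎)
    where
    u : Carrier
    u = sq R (a + p) * (q * p)
    polynomial-identity : ∀ q a p → let b = a + p; u = b * b * (q * p) in
      (b + q * p) * (b + q * p) * (b * b) + u * (q * a + 1#)
        ≈ b * b * (a * a)
          + ((p + q * p + q * (q * p)) * (b * b * b) + (p * a + q * p) * (b * b))
          + u * b
    polynomial-identity = solve 3 (λ q a p →
      let b = a :+ p
          u = b :* b :* (q :* p)
      in (b :+ q :* p) :* (b :+ q :* p) :* (b :* b) :+ u :* (q :* a :+ con 1)
         := b :* b :* (a :* a)
            :+ ((p :+ q :* p :+ q :* (q :* p)) :* (b :* b :* b) :+ (p :* a :+ q :* p) :* (b :* b))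
            :+ u :* b)
      refl

  lhs-summand : Carrier → ℕ → Carrier
  lhs-summand q i =
    (qpow R q (i ∸ 1) + qpow R q i + qpow R q (suc i)) * cube R (qint R q i)
    + (qpow R q (i ∸ 1) * qint R q (i ∸ 1) + qpow R q i) * sq R (qint R q i)

  rhs-zero : ∀ q → rhs R q 0 ≈ 0#
  rhs-zero q = trans (*-congˡ (zeroˡ 0#)) (zeroʳ _)

  rhs-suc : ∀ q n → rhs R q (suc n) ≈ rhs R q n + lhs-summand q (suc n)
  rhs-suc q n = rhs-step-identity q (qint R q n) (qpow R q n) (q*qint+1≈qint-suc q n)

  lhs≈rhs : ∀ q n → lhs R q n ≈ rhs R q n
  lhs≈rhs q n = begin
    lhs R q n                               ≈⟨ sum1-distrib-+ n _ _ ⟩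
    sum1 R n (lhs-summand q)                ≈⟨ +-identityˡ _ ⟨
    0# + sum1 R n (lhs-summand q)           ≈⟨ +-congʳ (rhs-zero q) ⟨
    rhs R q 0 + sum1 R n (lhs-summand q)    ≈⟨ sum1-telescope (rhs R q) (lhs-summand q) (rhs-suc q) n ⟩
    rhs R q n                               ∎

-- The identity holds for every n.
theorem12 : ∀ {c ℓ : Level} (R : CommutativeRing c ℓ) (q : CommutativeRing.Carrier R)
            (n : ℕ) → 2 ≤ n →
            CommutativeRing._≈_ R (lhs R q n) (rhs R q n)
theorem12 R q n _ = lhs≈rhs R q n
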